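{- Let $\xi\in\Lambda$. If $\xi\Vdash(\top,\bot\to\bot)$ and $\xi\Vdash(\bot,\top\to\bot)$, then $\xi\Vdash(\top,\top\to\bot)$. Consequently $\lambda x(x)\mathsf I\,\mathsf I\Vdash\neg\forall x^{\beth2}(x\neq0,x\neq1\to\bot)$ and $\mathsf W\Vdash\forall x^{\beth2}\big(\forall y^{\beth2}(y\neq0,y\neq x\to y\not\le x),\,x\neq0\to\bot\big)$.
   Context: Fix an integer $N\ge 0$. The BBC realizability algebra $(\Lambda,\Pi,\perp\!\!\!\perp)$: terms $\Lambda$ form the smallest set containing constants $\mathsf B,\mathsf C,\mathsf I,\mathsf K,\mathsf W,\mathsf{cc},\mathsf A$ and $\mathsf p,\mathsf q_0,\dots,\mathsf q_N$, closed under application $(\xi)\eta$, and such that to every sequence $(\xi_i)_{i\in\mathbb N}$ of closed terms (no occurrence of $\mathsf p,\mathsf q_0,\dots,\mathsf q_N$) is associated injectively and well-foundedly a new constant $\bigwedge_i\xi_i$. Stacks: $t_0\cdot\ldots\cdot t_{n-1}\cdot\pi_0$, $\pi_0$ the empty stack. Continuations $\mathsf k_{\pi_0}=\mathsf A$, $\mathsf k_{t\cdot\pi}=(\ell_t)\mathsf k_\pi$, $\ell_t=((\mathsf C)(\mathsf B)\mathsf C\mathsf B)t$; integers $\underline 0=(\mathsf K)\mathsf I$, $\underline{n+1}=(\sigma)\underline n$, $\sigma=(\mathsf B\mathsf W)(\mathsf C)(\mathsf B)\mathsf B\mathsf B$. Execution $\succ$: least preorder with $(\xi)\eta\star\pi\succ\xi\star\eta\cdot\pi$;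 $\mathsf B\star\xi\cdot\eta\cdot\zeta\cdot\pi\succ\xi\star(\eta)\zeta\cdot\pi$; $\mathsf C\star\xi\cdot\eta\cdot\zeta\cdot\pi\succ\xi\star\zeta\cdot\eta\cdot\pi$; $\mathsf I\star\xi\cdot\pi\succ\xi\star\pi$; $\mathsf K\star\xi\cdot\eta\cdot\pi\succ\xi\star\pi$; $\mathsf W\star\xi\cdot\eta\cdot\pi\succ\xi\star\eta\cdot\eta\cdot\pi$; $\mathsf{cc}\star\xi\cdot\pi\succ\xi\star\mathsf k_\pi\cdot\pi$; $\mathsf A\star\xi\cdot\pi\succ\xi\star\pi_0$; $\bigwedge_i\xi_i\star\underline n\cdot\pi\succ\xi_n\star\pi$. Pole $\perp\!\!\!\perp=\{\xi\star\pi:\exists\varpi,\ \xi\star\pi\succ\mathsf p\star\varpi\}$. Closed $\lambda$-terms are identified with terms built from $\mathsf B,\mathsf C,\mathsf I,\mathsf K,\mathsf W$ by standard compilation. Realizability: $\xi\Vdash F$ iff $\xi\star\pi\in\perp\!\!\!\perp$ for all $\pi\in\|F\|$, with $\|\bot\|=\Pi$, $\|\top\|=\emptyset$, $\|A\to B\|=\{\eta\cdot\pi:\eta\Vdash A,\pi\in\|B\|\}$; $A,B\to C$ means $A\to(B\to C)$ and $\neg A$ means $A\to\bot$. The quantifier over the characteristic Boolean algebra $\beth2$ (whose elements relevant here are $0$ and $1$) is interpreted by $\|\forall x^{\beth2}F[x]\|=\|F[0]\|\cup\|F[1]\|$; for $x,y\in\{0,1\}$ the formula $x\neq y$ is interpreted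 as $\top$ if $x\neq y$ and as $\bot$ if $x=y$, and $y\not\le x$ is interpreted as $\bot$ if $y\le x$ and $\top$ otherwise. -}

module Defs where

open import Data.Nat using (ℕ; zero; suc)
open import Data.Fin using (Fin)
open import Data.Bool using (Bool; true; false)
open import Data.List using (List; []; _∷_)
open import Data.Product using (Σ; _×_; _,_)
open import Data.Sum using (_⊎_)
open import Data.Empty using (⊥)
open import Data.Unit using (⊤)
open import Relation.Binary.Construct.Closure.ReflexiveTransitive using (Star)

module BBC (N : ℕ) where

  -- Tm true  : all terms Λ (may contain p, q₀ … q_N)
  -- Tm false : closed terms (no occurrence of p, q₀ … q_N)
  -- ⋀ f is the new constant associated with the sequence f of closed
  -- terms; injectivity and well-foundedness are given by the inductive type.
  infixl 9 _∙_
  data Tm : Bool → Set where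
    B C I K W cc A : ∀ {b} → Tm b
    p : Tm true
    q : Fin (suc N) → Tm true
    _∙_ : ∀ {b} → Tm b → Tm b → Tm b
    ⋀ : ∀ {b} → (ℕ → Tm false) → Tm b

  Λ : Set
  Λ = Tm true

  up : Tm false → Λ
  up B = B
  up C = C
  up I = I
  up K = K
  up W = W
  up cc = cc
  up A = A
  up (t ∙ u) = up t ∙ up u
  up (⋀ f) = ⋀ f

  Π : Set
  Π = List Λ   -- t₀ · … · t_{n-1} · π₀  ↦  t₀ ∷ … ∷ t_{n-1} ∷ []

  ℓ : Λ → Λ
  ℓ t = C ∙ (B ∙ C ∙ B) ∙ t

  k : Π → Λ
  k [] = A
  k (t ∷ π) = ℓ t ∙ k π

  σ : Λ
  σ = B ∙ W ∙ (C ∙ (B ∙ B ∙ B))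

  num : ℕ → Λ
  num zero = K ∙ I
  num (suc n) = σ ∙ num n

  Process : Set
  Process = Λ × Π

  data _↦_ : Process → Process → Set where
    push : ∀ {ξ η π} → (ξ ∙ η , π) ↦ (ξ , η ∷ π)
    stB  : ∀ {ξ η ζ π} → (B , ξ ∷ η ∷ ζ ∷ π) ↦ (ξ , η ∙ ζ ∷ π)
    stC  : ∀ {ξ η ζ π} → (C , ξ ∷ η ∷ ζ ∷ π) ↦ (ξ , ζ ∷ η ∷ π)
    stI  : ∀ {ξ π} → (I , ξ ∷ π) ↦ (ξ , π)
    stK  : ∀ {ξ η π} → (K , ξ ∷ η ∷ π) ↦ (ξ , π)
    stW  : ∀ {ξ η π} → (W , ξ ∷ η ∷ π) ↦ (ξ , η ∷ η ∷ π)
    stcc : ∀ {ξ π} → (cc , ξ ∷ π) ↦ (ξ , k π ∷ π)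
    stA  : ∀ {ξ π} → (A , ξ ∷ π) ↦ (ξ , [])
    st⋀  : ∀ {f n π} → (⋀ f , num n ∷ π) ↦ (up (f n) , π)

  _≻_ : Process → Process → Set
  _≻_ = Star _↦_

  ⫫ : Process → Set
  ⫫ P = Σ Π (λ ϖ → P ≻ (p , ϖ))

  FV : Set₁
  FV = Π → Set

  _⊩_ : Λ → FV → Set
  ξ ⊩ F = ∀ π → F π → ⫫ (ξ , π)

  ⊥v : FV
  ⊥v _ = ⊤

  ⊤v : FV
  ⊤v _ = ⊥

  infixr 5 _⇒_
  _⇒_ : FV → FV → FV
  (F ⇒ G) [] = ⊥
  (F ⇒ G) (η ∷ π) = (η ⊩ F) × G π

  ¬v : FV → FV
  ¬v F = F ⇒ ⊥v

  -- ∀x^{ב2}: 0 = false, 1 = true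
  ∀2 : (Bool → FV) → FV
  ∀2 F π = F false π ⊎ F true π

  _≠v_ : Bool → Bool → FV
  false ≠v false = ⊥v
  false ≠v true  = ⊤v
  true  ≠v false = ⊤v
  true  ≠v true  = ⊥v

  _≰v_ : Bool → Bool → FV
  true ≰v false = ⊤v
  _    ≰v _     = ⊥v

  -- standard compilation of λx (x) I I  is  ((C)((C)I)I)I
  λxxII : Λ
  λxxII = C ∙ (C ∙ I ∙ I) ∙ I

module Submission where

-- Fix a constant q = qⱼ.  If ξ ⋆ q·p·π and ξ ⋆ p·q·π both reach p, then for
-- all η, η′ the process ξ ⋆ η·η′·π reaches p.  Indeed, run the three
-- processes side by side: since execution is deterministic, the three
-- computations stay in lockstep, the third being the "merge" of the first
-- two — it agrees with them except at positions where one run holds q and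
-- the other p, where it holds η (q in the first run) or η′ (p in the first
-- run).  No run can inspect such a position: q and p have no reduction
-- rule, and the argument of ⋀ must be an integer, which contains neither.
-- When the first run reaches p, either the merged head is p too, or the
-- second run is stuck at q, a contradiction.

open import Defs
open import Data.Bool using (Bool; true; false)
open import Data.Nat using (ℕ; zero; suc)
open import Data.Fin using (Fin)
open import Data.Product using (_×_; _,_; Σ)
open import Data.Sum using (inj₁; inj₂)
open import Data.List using ([]; _∷_)
open import Data.Unit using (tt)
open import Relation.Binary.PropositionalEquality using (_≡_; refl; cong)
open import Relation.Binary.Construct.Closure.ReflexiveTransitive using (ε; _◅_; _◅◅_)

module Corollary7 (N : ℕ) where
  open BBC N

  -- Execution is deterministic; the only nontrivial case is ⋀, which needs
  -- the integers to be pairwise distinct terms.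
  ∙-injʳ : ∀ {a b c d : Λ} → a ∙ b ≡ c ∙ d → b ≡ d
  ∙-injʳ refl = refl

  num-injective : ∀ {n m} → num n ≡ num m → n ≡ m
  num-injective {zero}  {zero}  _ = refl
  num-injective {zero}  {suc m} ()
  num-injective {suc n} {zero}  ()
  num-injective {suc n} {suc m} e = cong suc (num-injective (∙-injʳ e))

  ⋀-step-inversion : ∀ {f s π Z} → (⋀ f , s ∷ π) ↦ Z →
                     Σ ℕ λ n → (s ≡ num n) × (Z ≡ (up (f n) , π))
  ⋀-step-inversion (st⋀ {n = n}) = n , refl , refl

  ↦-deterministic : ∀ {X Y Z} → X ↦ Y → X ↦ Z → Y ≡ Z
  ↦-deterministic push push = refl
  ↦-deterministic stB  stB  = refl
  ↦-deterministic stC  stC  = refl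
  ↦-deterministic stI  stI  = refl
  ↦-deterministic stK  stK  = refl
  ↦-deterministic stW  stW  = refl
  ↦-deterministic stcc stcc = refl
  ↦-deterministic stA  stA  = refl
  ↦-deterministic st⋀  s with ⋀-step-inversion s
  ... | m , e , refl with num-injective e
  ... | refl = refl

  ⫫-backward : ∀ {X Y} → X ≻ Y → ⫫ Y → ⫫ X
  ⫫-backward r (ϖ , r′) = ϖ , (r ◅◅ r′)

  continue : ∀ {X Y} → X ↦ Y → ⫫ Y → ⫫ X
  continue s = ⫫-backward (s ◅ ε)

  -- By determinism, and since p ⋆ π is final, a process reaching p still
  -- does so after any step.
  reaches-p-forward : ∀ {X Y ϖ} → X ↦ Y → X ≻ (p , ϖ) → Y ≻ (p , ϖ)
  reaches-p-forward () ε
  reaches-p-forward s (s′ ◅ r) with ↦-deterministic s s′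
  ... | refl = r

  data Merge (j : Fin (suc N)) (e₁ e₂ : Λ) : Λ → Λ → Λ → Set where
    same  : ∀ {x} → Merge j e₁ e₂ x x x
    left  : Merge j e₁ e₂ (q j) p e₁
    right : Merge j e₁ e₂ p (q j) e₂
    app   : ∀ {a₁ a₂ b c₁ c₂ d} → Merge j e₁ e₂ a₁ a₂ b → Merge j e₁ e₂ c₁ c₂ d →
            Merge j e₁ e₂ (a₁ ∙ c₁) (a₂ ∙ c₂) (b ∙ d)

  data MergeStack (j : Fin (suc N)) (e₁ e₂ : Λ) : Π → Π → Π → Set where
    []  : MergeStack j e₁ e₂ [] [] []
    _∷_ : ∀ {a₁ a₂ b π₁ π₂ ρ} → Merge j e₁ e₂ a₁ a₂ b → MergeStack j e₁ e₂ π₁ π₂ ρ →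
          MergeStack j e₁ e₂ (a₁ ∷ π₁) (a₂ ∷ π₂) (b ∷ ρ)

  merge-refl : ∀ {j e₁ e₂} π → MergeStack j e₁ e₂ π π π
  merge-refl []      = []
  merge-refl (_ ∷ π) = same ∷ merge-refl π

  merge-k : ∀ {j e₁ e₂ π₁ π₂ ρ} → MergeStack j e₁ e₂ π₁ π₂ ρ →
            Merge j e₁ e₂ (k π₁) (k π₂) (k ρ)
  merge-k []       = same
  merge-k (m ∷ ms) = app (app same m) (merge-k ms)

  data Pure : Λ → Set where
    B : Pure B
    C : Pure C
    I : Pure I
    K : Pure K
    W : Pure W
    cc : Pure cc
    A : Pure A
    ⋀   : ∀ {f} → Pure (⋀ f)
    app : ∀ {a c} → Pure a → Pure c → Pure (a ∙ c)

  pure-num : ∀ n → Pure (num n)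
  pure-num zero    = app K I
  pure-num (suc n) = app (app (app B W) (app C (app (app B B) B))) (pure-num n)

  merge-pure : ∀ {j e₁ e₂ a₁ a₂ b} → Merge j e₁ e₂ a₁ a₂ b → Pure a₁ → (a₂ ≡ a₁) × (b ≡ a₁)
  merge-pure same _ = refl , refl
  merge-pure (app ma mc) (app pa pc) with merge-pure ma pa | merge-pure mc pc
  ... | refl , refl | refl , refl = refl , refl

  -- Simulation lemma: if two merged processes both reach p, so does their
  -- merge.  By induction on the first execution, advancing the second one
  -- in lockstep.
  merge-reaches-p : ∀ {j e₁ e₂ a₁ a₂ b π₁ π₂ ρ ϖ₁ ϖ₂} →
                    Merge j e₁ e₂ a₁ a₂ b → MergeStack j e₁ e₂ π₁ π₂ ρ →
                    (a₁ , π₁) ≻ (p , ϖ₁) → (a₂ , π₂) ≻ (p , ϖ₂) → ⫫ (b , ρ)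
  merge-reaches-p same  _ ε _ = _ , ε
  merge-reaches-p right _ ε (() ◅ _)
  merge-reaches-p same ms (push ◅ r₁) r₂ =
    continue push (merge-reaches-p same (same ∷ ms) r₁ (reaches-p-forward push r₂))
  merge-reaches-p (app ma mc) ms (push ◅ r₁) r₂ =
    continue push (merge-reaches-p ma (mc ∷ ms) r₁ (reaches-p-forward push r₂))
  merge-reaches-p same (x ∷ y ∷ z ∷ ms) (stB ◅ r₁) r₂ =
    continue stB (merge-reaches-p x (app y z ∷ ms) r₁ (reaches-p-forward stB r₂))
  merge-reaches-p same (x ∷ y ∷ z ∷ ms) (stC ◅ r₁) r₂ =
    continue stC (merge-reaches-p x (z ∷ y ∷ ms) r₁ (reaches-p-forward stC r₂))
  merge-reaches-p same (x ∷ ms) (stI ◅ r₁) r₂ =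
    continue stI (merge-reaches-p x ms r₁ (reaches-p-forward stI r₂))
  merge-reaches-p same (x ∷ _ ∷ ms) (stK ◅ r₁) r₂ =
    continue stK (merge-reaches-p x ms r₁ (reaches-p-forward stK r₂))
  merge-reaches-p same (x ∷ y ∷ ms) (stW ◅ r₁) r₂ =
    continue stW (merge-reaches-p x (y ∷ y ∷ ms) r₁ (reaches-p-forward stW r₂))
  merge-reaches-p same (x ∷ ms) (stcc ◅ r₁) r₂ =
    continue stcc (merge-reaches-p x (merge-k ms ∷ ms) r₁ (reaches-p-forward stcc r₂))
  merge-reaches-p same (x ∷ _) (stA ◅ r₁) r₂ =
    continue stA (merge-reaches-p x [] r₁ (reaches-p-forward stA r₂))
  merge-reaches-p same (m ∷ ms) (st⋀ {n = n} ◅ r₁) r₂ with merge-pure m (pure-num n)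
  ... | refl , refl = continue st⋀ (merge-reaches-p same ms r₁ (reaches-p-forward st⋀ r₂))

  merge-probes : ∀ j {ξ η η′ π} → ⫫ (ξ , q j ∷ p ∷ π) → ⫫ (ξ , p ∷ q j ∷ π) →
                 ⫫ (ξ , η ∷ η′ ∷ π)
  merge-probes _ (_ , r₁) (_ , r₂) = merge-reaches-p same (left ∷ right ∷ merge-refl _) r₁ r₂

  realizes-⊤ : ∀ ξ → ξ ⊩ ⊤v
  realizes-⊤ _ _ ()

  p-realizes : ∀ F → p ⊩ F
  p-realizes _ π _ = π , ε

  theorem6 : (ξ : Λ) → ξ ⊩ (⊤v ⇒ ⊥v ⇒ ⊥v) → ξ ⊩ (⊥v ⇒ ⊤v ⇒ ⊥v) → ξ ⊩ (⊤v ⇒ ⊤v ⇒ ⊥v)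
  theorem6 ξ ξ⊩⊤⊥ ξ⊩⊥⊤ (η ∷ η′ ∷ π) _ =
    merge-probes Fin.zero
      (ξ⊩⊤⊥ (q Fin.zero ∷ p ∷ π) (realizes-⊤ _ , p-realizes ⊥v , tt))
      (ξ⊩⊥⊤ (p ∷ q Fin.zero ∷ π) (p-realizes ⊥v , realizes-⊤ _ , tt))

  -- A realizer of ∀x^{ב2} F realizes both instances F 0 and F 1.
  -- (F is explicit: it cannot be recovered from the unfolded falsity value.)
  ∀2-elim : ∀ {ξ} F → ξ ⊩ ∀2 F → ∀ b → ξ ⊩ F b
  ∀2-elim _ ξ⊩ false π f = ξ⊩ π (inj₁ f)
  ∀2-elim _ ξ⊩ true  π f = ξ⊩ π (inj₂ f)

  F : Bool → FV
  F x = x ≠v false ⇒ x ≠v true ⇒ ⊥v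

  G : Bool → Bool → FV
  G x y = y ≠v false ⇒ y ≠v x ⇒ y ≰v x

  -- λx (x) I I ⋆ η·π executes to η ⋆ I·I·π, and Theorem 6 applies to η.
  λxxII-realizes : λxxII ⊩ ¬v (∀2 F)
  λxxII-realizes (η ∷ π) (η⊩ , _) =
    ⫫-backward (push ◅ push ◅ stC ◅ push ◅ push ◅ stC ◅ stI ◅ ε)
      (theorem6 η (∀2-elim F η⊩ true) (∀2-elim F η⊩ false) (I ∷ I ∷ π)
        (realizes-⊤ I , realizes-⊤ I , tt))

  -- W ⋆ η·η′·π executes to η ⋆ η′·η′·π.  For x = 0, η′ realizes ⊥ and the
  -- instance y = 0 of the hypothesis on η applies; for x = 1, Theorem 6 does.
  W-realizes : W ⊩ ∀2 (λ x → ∀2 (G x) ⇒ x ≠v false ⇒ ⊥v)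
  W-realizes (η ∷ η′ ∷ π) (inj₁ (η⊩ , η′⊩⊥ , _)) =
    continue stW (∀2-elim (G false) η⊩ false (η′ ∷ η′ ∷ π) (η′⊩⊥ , η′⊩⊥ , tt))
  W-realizes (η ∷ η′ ∷ π) (inj₂ (η⊩ , _ , _)) =
    continue stW (theorem6 η (∀2-elim (G true) η⊩ true) (∀2-elim (G true) η⊩ false)
      (η′ ∷ η′ ∷ π) (realizes-⊤ η′ , realizes-⊤ η′ , tt))

corollary7 : (N : ℕ) → let open BBC N in
    ((ξ : Λ) → ξ ⊩ (⊤v ⇒ ⊥v ⇒ ⊥v) → ξ ⊩ (⊥v ⇒ ⊤v ⇒ ⊥v) → ξ ⊩ (⊤v ⇒ ⊤v ⇒ ⊥v))
    × (λxxII ⊩ ¬v (∀2 (λ x → x ≠v false ⇒ x ≠v true ⇒ ⊥v)))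
    × (W ⊩ ∀2 (λ x → ∀2 (λ y → y ≠v false ⇒ y ≠v x ⇒ y ≰v x) ⇒ x ≠v false ⇒ ⊥v))
corollary7 N = theorem6 , λxxII-realizes , W-realizes
  where open Corollary7 N
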